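{- Let $\mathbf{G}$ be a group, $a,b\in G$, and $T,T'$ binary trees with leaves $1,\dots,n$ (left to right). Then $T\sim_{(a,b),\mathbf{G}}T'$ holds if and only if $(\mathrm{ld}_T(i)-\mathrm{ld}_{T'}(i),\mathrm{rd}_T(i)-\mathrm{rd}_{T'}(i))\in\Lambda_{\mathbf{G}}(a,b)$ for all $i\in\{1,\dots,n\}$.
   Context: A binary tree is a finite rooted plane tree in which every internal vertex has exactly two ordered children (left and right). The address $\mathrm{addr}_T(v)$ of a vertex $v$ is the word over $\{0,1\}$ recording the path from the root to $v$ ($0$ = left step, $1$ = right step); $\mathrm{ld}_T(v)$ and $\mathrm{rd}_T(v)$ are the numbers of $0$'s and $1$'s in it. For a group $\mathbf{G}$ with neutral element $1$ and $a,b\in G$: $\gamma_0=a$, $\gamma_1=b$, $\gamma_\varepsilon=1$, $\gamma_{iw}=\gamma_i\gamma_w$; $T\sim_{(a,b),\mathbf{G}}T'$ (for $T,T'$ with $n$ leaves) iff $\gamma_{\mathrm{addr}_T(i)}=\gamma_{\mathrm{addr}_{T'}(i)}$ for all leaves $i$. $\Lambda_{\mathbf{G}}(a,b)=\{(r,s)\in\mathbb{Z}\times\mathbb{Z}:ba^rb^{ -1}=ab^{ -s}a^{ -1}\}$. -}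

module Defs where

open import Level using (Level)
open import Data.Nat as ℕ using (ℕ; zero; suc)
open import Data.Integer as ℤ using (ℤ; +_; -[1+_])
open import Data.Fin using (Fin; splitAt)
open import Data.Sum using (inj₁; inj₂)
open import Data.List using (List; []; _∷_)
open import Data.Product using (_×_)
open import Algebra.Bundles using (Group)

-- Binary trees indexed by their number of leaves.
-- Leaves are numbered 0 … n-1 (Fin n), left to right.
data Tree : ℕ → Set where
  leaf : Tree 1
  node : ∀ {m n} → Tree m → Tree n → Tree (m ℕ.+ n)

-- Letters of addresses: 𝟘 = left step, 𝟙 = right step.
data Bit : Set where
  𝟘 𝟙 : Bit

addr : ∀ {n} → Tree n → Fin n → List Bit
addr leaf _ = []
addr (node {m} L R) i with splitAt m i
... | inj₁ j = 𝟘 ∷ addr L j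
... | inj₂ k = 𝟙 ∷ addr R k

count0 count1 : List Bit → ℕ
count0 [] = 0
count0 (𝟘 ∷ w) = suc (count0 w)
count0 (𝟙 ∷ w) = count0 w
count1 [] = 0
count1 (𝟘 ∷ w) = count1 w
count1 (𝟙 ∷ w) = suc (count1 w)

ld rd : ∀ {n} → Tree n → Fin n → ℕ
ld T i = count0 (addr T i)
rd T i = count1 (addr T i)

module _ {c ℓ : Level} (G : Group c ℓ) where
  open Group G

  γ : Carrier → Carrier → List Bit → Carrier
  γ a b [] = ε
  γ a b (𝟘 ∷ w) = a ∙ γ a b w
  γ a b (𝟙 ∷ w) = b ∙ γ a b w

  Equiv : Carrier → Carrier → ∀ {n} → Tree n → Tree n → Set ℓ
  Equiv a b {n} T T' = ∀ (i : Fin n) → γ a b (addr T i) ≈ γ a b (addr T' i)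

  powℕ : Carrier → ℕ → Carrier
  powℕ x zero = ε
  powℕ x (suc k) = x ∙ powℕ x k

  powℤ : Carrier → ℤ → Carrier
  powℤ x (+ k) = powℕ x k
  powℤ x -[1+ k ] = (powℕ x (suc k)) ⁻¹

  Λ : Carrier → Carrier → ℤ × ℤ → Set ℓ
  Λ a b (r Data.Product., s) =
    (b ∙ powℤ a r) ∙ b ⁻¹ ≈ (a ∙ powℤ b (ℤ.- s)) ∙ a ⁻¹

-- Consecutive leaves of a binary tree have addresses u0 1^k and u1 0^l. If the leaf i of T
-- and of T' satisfies both the γ-equation and the Λ-condition, then at leaf i + 1 each of the
-- two conditions is equivalent to the same equation  a b^(k'-k) a⁻¹ = b a^(l'-l) b⁻¹:  the
-- γ-equation because γ(u) a b^k = γ(u') a b^k' pins down γ(u')⁻¹ γ(u), the Λ-condition because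
-- r ↦ b a^r b⁻¹ and s ↦ a b^s a⁻¹ are homomorphisms on ℤ. At the first leaves, 0^l and 0^l',
-- both conditions say a^l = a^l'. The equivalence then propagates from left to right.

module Submission where

open import Defs
open import Data.Fin using (Fin)
open import Data.Integer using (+_; _-_)
open import Data.Product using (_,_)
open import Function.Bundles using (_⇔_)
open import Algebra.Bundles using (Group)

open import Data.Nat.Base as ℕ using (ℕ; zero; suc)
import Data.Nat.Properties as ℕ
open import Data.Integer.Base as ℤ using (ℤ; -[1+_]; _⊖_; _+_; -_)
import Data.Integer.Properties as ℤ
open import Data.Integer.Solver using (module +-*-Solver)
open import Data.Fin.Base as Fin using (toℕ; splitAt; inject₁)
import Data.Fin.Properties as Fin
open import Data.Fin.Induction using (<-weakInduction)
open import Data.List.Base using (List; []; _∷_; _++_; replicate)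
open import Data.Product.Base using (_×_)
open import Data.Sum.Base using (inj₁; inj₂)
open import Data.Empty using (⊥-elim)
open import Function.Bundles using (mk⇔; Equivalence)
import Function.Properties.Equivalence as ⇔
open import Relation.Binary.PropositionalEquality as ≡ using (_≡_; refl; cong; cong₂; subst)

count0-++ : ∀ u v → count0 (u ++ v) ≡ count0 u ℕ.+ count0 v
count0-++ []      v = refl
count0-++ (𝟘 ∷ u) v = cong suc (count0-++ u v)
count0-++ (𝟙 ∷ u) v = count0-++ u v

count1-++ : ∀ u v → count1 (u ++ v) ≡ count1 u ℕ.+ count1 v
count1-++ []      v = refl
count1-++ (𝟘 ∷ u) v = count1-++ u v
count1-++ (𝟙 ∷ u) v = cong suc (count1-++ u v)

count0-replicate-𝟘 : ∀ k → count0 (replicate k 𝟘) ≡ k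
count0-replicate-𝟘 zero    = refl
count0-replicate-𝟘 (suc k) = cong suc (count0-replicate-𝟘 k)

count1-replicate-𝟘 : ∀ k → count1 (replicate k 𝟘) ≡ 0
count1-replicate-𝟘 zero    = refl
count1-replicate-𝟘 (suc k) = count1-replicate-𝟘 k

count0-replicate-𝟙 : ∀ k → count0 (replicate k 𝟙) ≡ 0
count0-replicate-𝟙 zero    = refl
count0-replicate-𝟙 (suc k) = count0-replicate-𝟙 k

count1-replicate-𝟙 : ∀ k → count1 (replicate k 𝟙) ≡ k
count1-replicate-𝟙 zero    = refl
count1-replicate-𝟙 (suc k) = cong suc (count1-replicate-𝟙 k)

-[+m-+n]≡n⊖m : ∀ m n → - (+ m - + n) ≡ n ⊖ m
-[+m-+n]≡n⊖m m n = ≡.trans (cong -_ (ℤ.m-n≡m⊖n m n)) (≡.sym (ℤ.⊖-swap n m))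

Δ : (List Bit → ℕ) → List Bit → List Bit → ℤ
Δ f w w' = + f w - + f w'

displacement : List Bit → List Bit → ℤ × ℤ
displacement w w' = Δ count0 w w' , Δ count1 w w'

Δ-++ : ∀ f → (∀ u v → f (u ++ v) ≡ f u ℕ.+ f v) →
       ∀ u u' {v v' m m'} → f v ≡ m → f v' ≡ m' →
       Δ f (u ++ v) (u' ++ v') ≡ Δ f u u' + (+ m - + m')
Δ-++ f f-++ u u' {v} {v'} refl refl
  rewrite f-++ u v | f-++ u' v' | ℤ.pos-+ (f u) (f v) | ℤ.pos-+ (f u') (f v') =
  solve 4 (λ x y x' y' → (x :+ y) :- (x' :+ y') := (x :- x') :+ (y :- y'))
          refl (+ f u) (+ f v) (+ f u') (+ f v')
  where open +-*-Solver

displacement-𝟘𝟙 : ∀ u u' k k' → displacement (u ++ 𝟘 ∷ replicate k 𝟙) (u' ++ 𝟘 ∷ replicate k' 𝟙)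
                  ≡ (Δ count0 u u' , Δ count1 u u' + (+ k - + k'))
displacement-𝟘𝟙 u u' k k' = cong₂ _,_
  (≡.trans (Δ-++ count0 count0-++ u u' (cong suc (count0-replicate-𝟙 k))
                                        (cong suc (count0-replicate-𝟙 k')))
           (ℤ.+-identityʳ _))
  (Δ-++ count1 count1-++ u u' (count1-replicate-𝟙 k) (count1-replicate-𝟙 k'))

displacement-𝟙𝟘 : ∀ u u' l l' → displacement (u ++ 𝟙 ∷ replicate l 𝟘) (u' ++ 𝟙 ∷ replicate l' 𝟘)
                  ≡ (Δ count0 u u' + (+ l - + l') , Δ count1 u u')
displacement-𝟙𝟘 u u' l l' = cong₂ _,_
  (Δ-++ count0 count0-++ u u' (count0-replicate-𝟘 l) (count0-replicate-𝟘 l'))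
  (≡.trans (Δ-++ count1 count1-++ u u' (cong suc (count1-replicate-𝟘 l))
                                        (cong suc (count1-replicate-𝟘 l')))
           (ℤ.+-identityʳ _))

displacement-replicate-𝟘 : ∀ l l' →
                           displacement (replicate l 𝟘) (replicate l' 𝟘) ≡ (+ l - + l' , + 0 - + 0)
displacement-replicate-𝟘 l l' = cong₂ _,_
  (cong₂ (λ m n → + m - + n) (count0-replicate-𝟘 l) (count0-replicate-𝟘 l'))
  (cong₂ (λ m n → + m - + n) (count1-replicate-𝟘 l) (count1-replicate-𝟘 l'))

data Leftmost : List Bit → Set where
  leftmost : ∀ l → Leftmost (replicate l 𝟘)

data Rightmost : List Bit → Set where
  rightmost : ∀ k → Rightmost (replicate k 𝟙)

data Adjacent : List Bit → List Bit → Set where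
  adjacent : ∀ u k l → Adjacent (u ++ 𝟘 ∷ replicate k 𝟙) (u ++ 𝟙 ∷ replicate l 𝟘)

Leftmost-𝟘∷ : ∀ {w} → Leftmost w → Leftmost (𝟘 ∷ w)
Leftmost-𝟘∷ (leftmost l) = leftmost (suc l)

Rightmost-𝟙∷ : ∀ {w} → Rightmost w → Rightmost (𝟙 ∷ w)
Rightmost-𝟙∷ (rightmost k) = rightmost (suc k)

Adjacent-∷ : ∀ x {w v} → Adjacent w v → Adjacent (x ∷ w) (x ∷ v)
Adjacent-∷ x (adjacent u k l) = adjacent (x ∷ u) k l

Rightmost-Leftmost⇒Adjacent : ∀ {w v} → Rightmost w → Leftmost v → Adjacent (𝟘 ∷ w) (𝟙 ∷ v)
Rightmost-Leftmost⇒Adjacent (rightmost k) (leftmost l) = adjacent [] k l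

leaves>0 : ∀ {n} → Tree n → 0 ℕ.< n
leaves>0 leaf               = ℕ.z<s
leaves>0 (node {m} {n} L R) = ℕ.≤-trans (leaves>0 L) (ℕ.m≤m+n m n)

toℕ-splitAt-inj₁ : ∀ m {n} {i : Fin (m ℕ.+ n)} {j} → splitAt m i ≡ inj₁ j → toℕ i ≡ toℕ j
toℕ-splitAt-inj₁ m {n} {j = j} eq =
  ≡.trans (≡.sym (cong toℕ (Fin.splitAt⁻¹-↑ˡ eq))) (Fin.toℕ-↑ˡ j n)

toℕ-splitAt-inj₂ : ∀ m {n} {i : Fin (m ℕ.+ n)} {j} → splitAt m i ≡ inj₂ j → toℕ i ≡ m ℕ.+ toℕ j
toℕ-splitAt-inj₂ m {j = j} eq =
  ≡.trans (≡.sym (cong toℕ (Fin.splitAt⁻¹-↑ʳ eq))) (Fin.toℕ-↑ʳ m j)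

first-leaf : ∀ {n} (T : Tree n) (i : Fin n) → toℕ i ≡ 0 → Leftmost (addr T i)
first-leaf leaf               i i≡0 = leftmost 0
first-leaf (node {m} L R) i i≡0 with splitAt m i in eq
... | inj₁ j = Leftmost-𝟘∷ (first-leaf L j (≡.trans (≡.sym (toℕ-splitAt-inj₁ m eq)) i≡0))
... | inj₂ j = ⊥-elim (ℕ.<-irrefl (≡.sym m≡0) (leaves>0 L))
  where
  m≡0 : m ≡ 0
  m≡0 = ℕ.m+n≡0⇒m≡0 m (≡.trans (≡.sym (toℕ-splitAt-inj₂ m eq)) i≡0)

last-leaf : ∀ {n} (T : Tree n) (i : Fin n) → suc (toℕ i) ≡ n → Rightmost (addr T i)
last-leaf leaf                 i i-last = rightmost 0
last-leaf (node {m} {n} L R) i i-last with splitAt m i in eq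
... | inj₁ j = ⊥-elim (ℕ.≤⇒≯ m+n≤m (ℕ.m<m+n m (leaves>0 R)))
  where
  m+n≤m : m ℕ.+ n ℕ.≤ m
  m+n≤m = subst (ℕ._≤ m) (≡.trans (cong suc (≡.sym (toℕ-splitAt-inj₁ m eq))) i-last) (Fin.toℕ<n j)
... | inj₂ j = Rightmost-𝟙∷ (last-leaf R j (ℕ.+-cancelˡ-≡ m _ _
  (≡.trans (ℕ.+-suc m (toℕ j)) (≡.trans (cong suc (≡.sym (toℕ-splitAt-inj₂ m eq))) i-last))))

-- Two consecutive leaves on different sides of the root are the last leaf on the left and the
-- first leaf on the right.
straddle : ∀ {m i j} → i ℕ.< m → suc i ≡ m ℕ.+ j → suc i ≡ m × j ≡ 0
straddle {m} {i} {j} i<m i⋖m+j =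
  ≡.trans i⋖m+j m+j≡m , ℕ.+-cancelˡ-≡ m j 0 (≡.trans m+j≡m (≡.sym (ℕ.+-identityʳ m)))
  where
  m+j≡m : m ℕ.+ j ≡ m
  m+j≡m = ℕ.≤-antisym (subst (ℕ._≤ m) i⋖m+j i<m) (ℕ.m≤m+n m j)

adjacent-leaves : ∀ {n} (T : Tree n) (i j : Fin n) → suc (toℕ i) ≡ toℕ j →
                  Adjacent (addr T i) (addr T j)
adjacent-leaves leaf Fin.zero Fin.zero ()
adjacent-leaves (node {m} L R) i j i⋖j with splitAt m i in eqi | splitAt m j in eqj
... | inj₁ i' | inj₁ j' = Adjacent-∷ 𝟘 (adjacent-leaves L i' j'
  (≡.trans (cong suc (≡.sym (toℕ-splitAt-inj₁ m eqi))) (≡.trans i⋖j (toℕ-splitAt-inj₁ m eqj))))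
... | inj₂ i' | inj₂ j' = Adjacent-∷ 𝟙 (adjacent-leaves R i' j' (ℕ.+-cancelˡ-≡ m _ _
  (≡.trans (ℕ.+-suc m (toℕ i'))
    (≡.trans (cong suc (≡.sym (toℕ-splitAt-inj₂ m eqi))) (≡.trans i⋖j (toℕ-splitAt-inj₂ m eqj))))))
... | inj₁ i' | inj₂ j' with straddle (Fin.toℕ<n i')
  (≡.trans (cong suc (≡.sym (toℕ-splitAt-inj₁ m eqi))) (≡.trans i⋖j (toℕ-splitAt-inj₂ m eqj)))
...   | i'-last , j'-first =
  Rightmost-Leftmost⇒Adjacent (last-leaf L i' i'-last) (first-leaf R j' j'-first)
adjacent-leaves (node {m} L R) i j i⋖j | inj₂ i' | inj₁ j' =
  ⊥-elim (ℕ.m+n≮m m (suc (toℕ i')) m+1+i'<m)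
  where
  m+1+i'<m : m ℕ.+ suc (toℕ i') ℕ.< m
  m+1+i'<m = subst (ℕ._< m)
    (≡.trans (≡.sym (toℕ-splitAt-inj₁ m eqj)) (≡.trans (≡.sym i⋖j)
      (≡.trans (cong suc (toℕ-splitAt-inj₂ m eqi)) (≡.sym (ℕ.+-suc m (toℕ i'))))))
    (Fin.toℕ<n j')

Fin-chain : ∀ {ℓ n} {P Q : Fin n → Set ℓ} →
            (∀ i → toℕ i ≡ 0 → P i → Q i) →
            (∀ i j → suc (toℕ i) ≡ toℕ j → P i → Q i → P j → Q j) →
            (∀ i → P i) → ∀ i → Q i
Fin-chain {n = zero}          base step allP ()
Fin-chain {n = suc n} {Q = Q} base step allP =
  <-weakInduction Q (base Fin.zero refl (allP Fin.zero)) λ j Qj →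
    step (inject₁ j) (Fin.suc j) (cong suc (Fin.toℕ-inject₁ j)) (allP _) Qj (allP (Fin.suc j))

Fin-chain-⇔ : ∀ {ℓ n} {P Q : Fin n → Set ℓ} →
              (∀ i → toℕ i ≡ 0 → P i ⇔ Q i) →
              (∀ i j → suc (toℕ i) ≡ toℕ j → P i → Q i → P j ⇔ Q j) →
              (∀ i → P i) ⇔ (∀ i → Q i)
Fin-chain-⇔ base step = mk⇔
  (Fin-chain (λ i i≡0 → to (base i i≡0)) (λ i j i⋖j p q → to (step i j i⋖j p q)))
  (Fin-chain (λ i i≡0 → from (base i i≡0)) (λ i j i⋖j q p → from (step i j i⋖j p q)))
  where open Equivalence

module GroupProperties {c ℓ} (G : Group c ℓ) where
  open Group G hiding (_-_) renaming (refl to ≈-refl; sym to ≈-sym; trans to ≈-trans)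
  open import Algebra.Properties.Group G
  open import Algebra.Solver.Monoid monoid using (solve; _⊜_; _⊕_)
  open import Relation.Binary.Reasoning.Setoid setoid

  ≈-⇔ : ∀ {x x' y y'} → x ≈ x' → y ≈ y' → (x ≈ y ⇔ x' ≈ y')
  ≈-⇔ x≈x' y≈y' = mk⇔ (λ h → ≈-trans (≈-sym x≈x') (≈-trans h y≈y'))
                        (λ h → ≈-trans x≈x' (≈-trans h (≈-sym y≈y')))

  x∙y≈z∙w⇔z\\x≈w//y : ∀ x y z w → (x ∙ y ≈ z ∙ w ⇔ z \\ x ≈ w // y)
  x∙y≈z∙w⇔z\\x≈w//y x y z w = mk⇔ to from
    where
    to : x ∙ y ≈ z ∙ w → z \\ x ≈ w // y
    to h = x≈z//y (z \\ x) y w (≈-trans (assoc _ _ _) (≈-sym (y≈x\\z z w (x ∙ y) (≈-sym h))))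
    from : z \\ x ≈ w // y → x ∙ y ≈ z ∙ w
    from h = begin
      x ∙ y              ≈⟨ ∙-congʳ (\\-leftDividesˡ z x) ⟨
      z ∙ (z \\ x) ∙ y   ≈⟨ ∙-congʳ (∙-congˡ h) ⟩
      z ∙ (w // y) ∙ y   ≈⟨ assoc _ _ _ ⟩
      z ∙ ((w // y) ∙ y) ≈⟨ ∙-congˡ (//-rightDividesˡ y w) ⟩
      z ∙ w              ∎

  -- Both sides of the equivalence determine g' \\ g.
  ∙≈∙-transfer : ∀ {g g' x x' y y'} → g ∙ x ≈ g' ∙ x' →
                 (g ∙ y ≈ g' ∙ y' ⇔ x' // x ≈ y' // y)
  ∙≈∙-transfer {g} {g'} {x} {x'} {y} {y'} h =
    ⇔.trans (x∙y≈z∙w⇔z\\x≈w//y g y g' y')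
            (≈-⇔ (Equivalence.to (x∙y≈z∙w⇔z\\x≈w//y g x g' x') h) ≈-refl)

  conj : Carrier → Carrier → Carrier
  conj c x = c ∙ x ∙ c ⁻¹

  conj-cong : ∀ c {x y} → x ≈ y → conj c x ≈ conj c y
  conj-cong c x≈y = ∙-congʳ (∙-congˡ x≈y)

  conj-∙ : ∀ c x y → conj c (x ∙ y) ≈ conj c x ∙ conj c y
  conj-∙ c x y = begin
    c ∙ (x ∙ y) ∙ c ⁻¹
      ≈⟨ solve 4 (λ c x y c' → (c ⊕ (x ⊕ y)) ⊕ c' ⊜ (c ⊕ x) ⊕ (y ⊕ c')) ≈-refl c x y (c ⁻¹) ⟩
    c ∙ x ∙ (y ∙ c ⁻¹)
      ≈⟨ ∙-congˡ (\\-leftDividesʳ c _) ⟨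
    c ∙ x ∙ (c ⁻¹ ∙ (c ∙ (y ∙ c ⁻¹)))
      ≈⟨ solve 4 (λ c x y c' → (c ⊕ x) ⊕ (c' ⊕ (c ⊕ (y ⊕ c'))) ⊜ ((c ⊕ x) ⊕ c') ⊕ ((c ⊕ y) ⊕ c'))
               ≈-refl c x y (c ⁻¹) ⟩
    conj c x ∙ conj c y
      ∎

  conj-ε : ∀ c → conj c ε ≈ ε
  conj-ε c = ≈-trans (∙-congʳ (identityʳ c)) (inverseʳ c)

  conj-⁻¹ : ∀ c x → conj c (x ⁻¹) ≈ conj c x ⁻¹
  conj-⁻¹ c x = inverseʳ-unique (conj c x) (conj c (x ⁻¹)) (begin
    conj c x ∙ conj c (x ⁻¹)  ≈⟨ conj-∙ c x (x ⁻¹) ⟨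
    conj c (x ∙ x ⁻¹)         ≈⟨ conj-cong c (inverseʳ x) ⟩
    conj c ε                  ≈⟨ conj-ε c ⟩
    ε                         ∎)

  conj≈ε⇔≈ε : ∀ c x → (conj c x ≈ ε ⇔ x ≈ ε)
  conj≈ε⇔≈ε c x = mk⇔
    (λ h → identityʳ-unique c x (x∙y⁻¹≈ε⇒x≈y (c ∙ x) c h))
    (λ h → ≈-trans (conj-cong c h) (conj-ε c))

  ∙-//-conj : ∀ c x y → (c ∙ x) // (c ∙ y) ≈ conj c (x // y)
  ∙-//-conj c x y = begin
    c ∙ x ∙ (c ∙ y) ⁻¹       ≈⟨ ∙-congˡ (⁻¹-anti-homo-∙ c y) ⟩
    c ∙ x ∙ (y ⁻¹ ∙ c ⁻¹)
      ≈⟨ solve 4 (λ c x y' c' → (c ⊕ x) ⊕ (y' ⊕ c') ⊜ (c ⊕ (x ⊕ y')) ⊕ c')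
               ≈-refl c x (y ⁻¹) (c ⁻¹) ⟩
    conj c (x // y)          ∎

  powℕ-+ : ∀ x m n → powℕ G x (m ℕ.+ n) ≈ powℕ G x m ∙ powℕ G x n
  powℕ-+ x zero    n = ≈-sym (identityˡ _)
  powℕ-+ x (suc m) n = ≈-trans (∙-congˡ (powℕ-+ x m n)) (≈-sym (assoc _ _ _))

  powℕ-sucʳ : ∀ x m → powℕ G x (suc m) ≈ powℕ G x m ∙ x
  powℕ-sucʳ x m = begin
    powℕ G x (suc m)         ≡⟨ cong (powℕ G x) (ℕ.+-comm 1 m) ⟩
    powℕ G x (m ℕ.+ 1)       ≈⟨ powℕ-+ x m 1 ⟩
    powℕ G x m ∙ (x ∙ ε)     ≈⟨ ∙-congˡ (identityʳ x) ⟩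
    powℕ G x m ∙ x           ∎

  ∙\\∙-cancelˡ : ∀ c x y → (c ∙ x) \\ (c ∙ y) ≈ x \\ y
  ∙\\∙-cancelˡ c x y = begin
    (c ∙ x) ⁻¹ ∙ (c ∙ y)       ≈⟨ ∙-congʳ (⁻¹-anti-homo-∙ c x) ⟩
    x ⁻¹ ∙ c ⁻¹ ∙ (c ∙ y)      ≈⟨ assoc _ _ _ ⟩
    x ⁻¹ ∙ (c ⁻¹ ∙ (c ∙ y))    ≈⟨ ∙-congˡ (\\-leftDividesʳ c y) ⟩
    x ⁻¹ ∙ y                   ∎

  ∙//∙-cancelʳ : ∀ c x y → (x ∙ c) // (y ∙ c) ≈ x // y
  ∙//∙-cancelʳ c x y = begin
    x ∙ c ∙ (y ∙ c) ⁻¹         ≈⟨ ∙-congˡ (⁻¹-anti-homo-∙ y c) ⟩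
    x ∙ c ∙ (c ⁻¹ ∙ y ⁻¹)      ≈⟨ assoc _ _ _ ⟨
    x ∙ c ∙ c ⁻¹ ∙ y ⁻¹        ≈⟨ ∙-congʳ (//-rightDividesʳ c x) ⟩
    x ∙ y ⁻¹                   ∎

  powℤ-⊖ˡ : ∀ x m n → powℤ G x (m ⊖ n) ≈ powℕ G x n \\ powℕ G x m
  powℤ-⊖ˡ x m       zero    = begin
    powℕ G x m          ≈⟨ identityˡ _ ⟨
    ε ∙ powℕ G x m      ≈⟨ ∙-congʳ ε⁻¹≈ε ⟨
    ε ⁻¹ ∙ powℕ G x m   ∎
  powℤ-⊖ˡ x zero    (suc n) = ≈-sym (identityʳ _)
  powℤ-⊖ˡ x (suc m) (suc n) = begin
    powℤ G x (suc m ⊖ suc n)                   ≡⟨ cong (powℤ G x) (ℤ.[1+m]⊖[1+n]≡m⊖n m n) ⟩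
    powℤ G x (m ⊖ n)                           ≈⟨ powℤ-⊖ˡ x m n ⟩
    powℕ G x n \\ powℕ G x m                   ≈⟨ ∙\\∙-cancelˡ x _ _ ⟨
    powℕ G x (suc n) \\ powℕ G x (suc m)       ∎

  powℤ-⊖ʳ : ∀ x m n → powℤ G x (m ⊖ n) ≈ powℕ G x m // powℕ G x n
  powℤ-⊖ʳ x m       zero    = begin
    powℕ G x m          ≈⟨ identityʳ _ ⟨
    powℕ G x m ∙ ε      ≈⟨ ∙-congˡ ε⁻¹≈ε ⟨
    powℕ G x m ∙ ε ⁻¹   ∎
  powℤ-⊖ʳ x zero    (suc n) = ≈-sym (identityˡ _)
  powℤ-⊖ʳ x (suc m) (suc n) = begin
    powℤ G x (suc m ⊖ suc n)                   ≡⟨ cong (powℤ G x) (ℤ.[1+m]⊖[1+n]≡m⊖n m n) ⟩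
    powℤ G x (m ⊖ n)                           ≈⟨ powℤ-⊖ʳ x m n ⟩
    powℕ G x m // powℕ G x n                   ≈⟨ ∙//∙-cancelʳ x _ _ ⟨
    (powℕ G x m ∙ x) // (powℕ G x n ∙ x)       ≈⟨ //-cong₂ (powℕ-sucʳ x m) (powℕ-sucʳ x n) ⟨
    powℕ G x (suc m) // powℕ G x (suc n)       ∎

  powℤ-+ : ∀ x i j → powℤ G x (i + j) ≈ powℤ G x i ∙ powℤ G x j
  powℤ-+ x (+ m)    (+ n)    = powℕ-+ x m n
  powℤ-+ x (+ m)    -[1+ n ] = powℤ-⊖ʳ x m (suc n)
  powℤ-+ x -[1+ m ] (+ n)    = powℤ-⊖ˡ x n (suc m)
  powℤ-+ x -[1+ m ] -[1+ n ] = begin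
    powℕ G x (suc (suc (m ℕ.+ n))) ⁻¹
      ≡⟨ cong (λ k → powℕ G x (suc k) ⁻¹) (ℕ.+-comm (suc m) n) ⟩
    powℕ G x (suc n ℕ.+ suc m) ⁻¹
      ≈⟨ ⁻¹-cong (powℕ-+ x (suc n) (suc m)) ⟩
    (powℕ G x (suc n) ∙ powℕ G x (suc m)) ⁻¹
      ≈⟨ ⁻¹-anti-homo-∙ _ _ ⟩
    powℕ G x (suc m) ⁻¹ ∙ powℕ G x (suc n) ⁻¹
      ∎

  powℤ-neg : ∀ x i → powℤ G x (- i) ≈ powℤ G x i ⁻¹
  powℤ-neg x i = inverseʳ-unique (powℤ G x i) (powℤ G x (- i)) (begin
    powℤ G x i ∙ powℤ G x (- i)   ≈⟨ powℤ-+ x i (- i) ⟨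
    powℤ G x (i + - i)            ≡⟨ cong (powℤ G x) (ℤ.+-inverseʳ i) ⟩
    ε                             ∎)

  conj-powℤ-+ : ∀ c x i j → conj c (powℤ G x (i + j)) ≈ conj c (powℤ G x i) ∙ conj c (powℤ G x j)
  conj-powℤ-+ c x i j = ≈-trans (conj-cong c (powℤ-+ x i j)) (conj-∙ c _ _)

  conj-powℤ-neg : ∀ c x i → conj c (powℤ G x (- i)) ≈ conj c (powℤ G x i) ⁻¹
  conj-powℤ-neg c x i = ≈-trans (conj-cong c (powℤ-neg x i)) (conj-⁻¹ c _)

  x∙y≈x⇔y≈ε : ∀ x y → (x ∙ y ≈ x ⇔ y ≈ ε)
  x∙y≈x⇔y≈ε x y = mk⇔ (identityʳ-unique x y) (λ h → ≈-trans (∙-congˡ h) (identityʳ x))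

  x∙y≈ε⇔x≈y⁻¹ : ∀ x y → (x ∙ y ≈ ε ⇔ x ≈ y ⁻¹)
  x∙y≈ε⇔x≈y⁻¹ x y = mk⇔ (inverseˡ-unique x y) (λ h → ≈-trans (∙-congʳ h) (inverseˡ y))

  x∙y⁻¹≈ε⇔x≈y : ∀ x y → (x ∙ y ⁻¹ ≈ ε ⇔ x ≈ y)
  x∙y⁻¹≈ε⇔x≈y x y = mk⇔ (x∙y⁻¹≈ε⇒x≈y x y) x≈y⇒x∙y⁻¹≈ε

module _ {c ℓ} (G : Group c ℓ) (a b : Group.Carrier G) where
  open Group G hiding (_-_) renaming (refl to ≈-refl; sym to ≈-sym; trans to ≈-trans)
  open GroupProperties G
  open import Relation.Binary.Reasoning.Setoid setoid

  Λ-base : ∀ m n → (Λ G a b (+ m - + n , + 0 - + 0) ⇔ powℕ G a m ≈ powℕ G a n)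
  Λ-base m n = ⇔.trans (≈-⇔ ≈-refl (conj-ε a)) (⇔.trans (conj≈ε⇔≈ε b _) (⇔.trans
    (≈-⇔ (≈-trans (reflexive (cong (powℤ G a) (ℤ.m-n≡m⊖n m n))) (powℤ-⊖ʳ a m n)) ≈-refl)
    (x∙y⁻¹≈ε⇔x≈y _ _)))

  Λ-step : ∀ r s i j → Λ G a b (r , s + i) →
           (Λ G a b (r + j , s) ⇔ conj a (powℤ G b (- i)) ≈ conj b (powℤ G a (- j)))
  Λ-step r s i j h = ⇔.trans (≈-⇔ split ≈-refl) (⇔.trans (x∙y≈x⇔y≈ε _ _) (⇔.trans (x∙y≈ε⇔x≈y⁻¹ _ _)
                       (≈-⇔ ≈-refl (≈-sym (conj-powℤ-neg b a j)))))
    where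
    X : ℤ → Carrier
    X r = conj b (powℤ G a r)
    Y : ℤ → Carrier
    Y s = conj a (powℤ G b s)
    split : X (r + j) ≈ Y (- s) ∙ (Y (- i) ∙ X j)
    split = begin
      X (r + j)                  ≈⟨ conj-powℤ-+ b a r j ⟩
      X r ∙ X j                  ≈⟨ ∙-congʳ h ⟩
      Y (- (s + i)) ∙ X j        ≡⟨ cong (λ t → Y t ∙ X j) (ℤ.neg-distrib-+ s i) ⟩
      Y (- s + - i) ∙ X j        ≈⟨ ∙-congʳ (conj-powℤ-+ a b (- s) (- i)) ⟩
      Y (- s) ∙ Y (- i) ∙ X j    ≈⟨ assoc _ _ _ ⟩
      Y (- s) ∙ (Y (- i) ∙ X j)  ∎

  γ-++ : ∀ u v → γ G a b (u ++ v) ≈ γ G a b u ∙ γ G a b v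
  γ-++ []      v = ≈-sym (identityˡ _)
  γ-++ (𝟘 ∷ u) v = ≈-trans (∙-congˡ (γ-++ u v)) (≈-sym (assoc _ _ _))
  γ-++ (𝟙 ∷ u) v = ≈-trans (∙-congˡ (γ-++ u v)) (≈-sym (assoc _ _ _))

  γ-replicate-𝟘 : ∀ k → γ G a b (replicate k 𝟘) ≡ powℕ G a k
  γ-replicate-𝟘 zero    = refl
  γ-replicate-𝟘 (suc k) = cong (a ∙_) (γ-replicate-𝟘 k)

  γ-replicate-𝟙 : ∀ k → γ G a b (replicate k 𝟙) ≡ powℕ G b k
  γ-replicate-𝟙 zero    = refl
  γ-replicate-𝟙 (suc k) = cong (b ∙_) (γ-replicate-𝟙 k)

  γ-𝟘𝟙 : ∀ u k → γ G a b (u ++ 𝟘 ∷ replicate k 𝟙) ≈ γ G a b u ∙ (a ∙ powℕ G b k)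
  γ-𝟘𝟙 u k = ≈-trans (γ-++ u _) (∙-congˡ (∙-congˡ (reflexive (γ-replicate-𝟙 k))))

  γ-𝟙𝟘 : ∀ u l → γ G a b (u ++ 𝟙 ∷ replicate l 𝟘) ≈ γ G a b u ∙ (b ∙ powℕ G a l)
  γ-𝟙𝟘 u l = ≈-trans (γ-++ u _) (∙-congˡ (∙-congˡ (reflexive (γ-replicate-𝟘 l))))

  SameGamma : List Bit → List Bit → Set ℓ
  SameGamma w w' = γ G a b w ≈ γ G a b w'

  InΛ : List Bit → List Bit → Set ℓ
  InΛ w w' = Λ G a b (displacement w w')

  Junction : ℕ → ℕ → ℕ → ℕ → Set ℓ
  Junction k k' l l' = conj a (powℤ G b (k' ⊖ k)) ≈ conj b (powℤ G a (l' ⊖ l))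

  γ-adjacent : ∀ u u' k k' l l' →
               SameGamma (u ++ 𝟘 ∷ replicate k 𝟙) (u' ++ 𝟘 ∷ replicate k' 𝟙) →
               (SameGamma (u ++ 𝟙 ∷ replicate l 𝟘) (u' ++ 𝟙 ∷ replicate l' 𝟘) ⇔ Junction k k' l l')
  γ-adjacent u u' k k' l l' h = ⇔.trans (≈-⇔ (γ-𝟙𝟘 u l) (γ-𝟙𝟘 u' l'))
    (⇔.trans (∙≈∙-transfer (≈-trans (≈-sym (γ-𝟘𝟙 u k)) (≈-trans h (γ-𝟘𝟙 u' k'))))
             (≈-⇔ (//-conj-powℤ a b k' k) (//-conj-powℤ b a l' l)))
    where
    //-conj-powℤ : ∀ c x m n → (c ∙ powℕ G x m) // (c ∙ powℕ G x n) ≈ conj c (powℤ G x (m ⊖ n))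
    //-conj-powℤ c x m n = ≈-trans (∙-//-conj c _ _) (conj-cong c (≈-sym (powℤ-⊖ʳ x m n)))

  Λ-adjacent : ∀ u u' k k' l l' →
               InΛ (u ++ 𝟘 ∷ replicate k 𝟙) (u' ++ 𝟘 ∷ replicate k' 𝟙) →
               (InΛ (u ++ 𝟙 ∷ replicate l 𝟘) (u' ++ 𝟙 ∷ replicate l' 𝟘) ⇔ Junction k k' l l')
  Λ-adjacent u u' k k' l l' h =
    subst (λ d → Λ G a b d ⇔ Junction k k' l l') (≡.sym (displacement-𝟙𝟘 u u' l l'))
      (⇔.trans (Λ-step (Δ count0 u u') (Δ count1 u u') (+ k - + k') (+ l - + l') h')
               (≈-⇔ (conj-cong a (reflexive (cong (powℤ G b) (-[+m-+n]≡n⊖m k k'))))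
                    (conj-cong b (reflexive (cong (powℤ G a) (-[+m-+n]≡n⊖m l l'))))))
    where
    h' : Λ G a b (Δ count0 u u' , Δ count1 u u' + (+ k - + k'))
    h' = subst (Λ G a b) (displacement-𝟘𝟙 u u' k k') h

  leftmost-⇔ : ∀ {w w'} → Leftmost w → Leftmost w' → (SameGamma w w' ⇔ InΛ w w')
  leftmost-⇔ (leftmost l) (leftmost l') =
    ⇔.trans (≈-⇔ (reflexive (γ-replicate-𝟘 l)) (reflexive (γ-replicate-𝟘 l')))
            (⇔.sym (subst (λ d → Λ G a b d ⇔ powℕ G a l ≈ powℕ G a l')
                          (≡.sym (displacement-replicate-𝟘 l l')) (Λ-base l l')))

  adjacent-⇔ : ∀ {w v w' v'} → Adjacent w v → Adjacent w' v' →
               SameGamma w w' → InΛ w w' → (SameGamma v v' ⇔ InΛ v v')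
  adjacent-⇔ (adjacent u k l) (adjacent u' k' l') γ-eq in-Λ =
    ⇔.trans (γ-adjacent u u' k k' l l' γ-eq) (⇔.sym (Λ-adjacent u u' k k' l l' in-Λ))

proposition5p5 : ∀ {c ℓ} (G : Group c ℓ) (a b : Group.Carrier G) {n : _} (T T' : Tree n) →
    Equiv G a b T T' ⇔
      (∀ (i : Fin n) → Λ G a b ((+ ld T i) - (+ ld T' i) , (+ rd T i) - (+ rd T' i)))
proposition5p5 G a b T T' = Fin-chain-⇔
  (λ i i≡0 → leftmost-⇔ G a b (first-leaf T i i≡0) (first-leaf T' i i≡0))
  (λ i j i⋖j → adjacent-⇔ G a b (adjacent-leaves T i j i⋖j) (adjacent-leaves T' i j i⋖j))
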